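{- Let $d\ge 4$ and $n\ge d^2+1$ be integers. Then the circulant graph $C_n^{1,d}$ is not a square.
   Context: For integers $1\le d_1<\dots<d_s\le n/2$, the circulant graph $C_n^{d_1,\dots,d_s}$ has vertex set $\{0,1,\dots,n-1\}$, with $i$ and $j$ adjacent iff $i-j\equiv \pm d_k \pmod n$ for some $1\le k\le s$. All graphs are finite and simple. A partially labeled graph is a graph $H$ together with an injective map $\theta: L\to V(H)$, $L\subseteq\mathbb{N}$, whose image $\theta(L)$ is nonempty and a proper subset of $V(H)$; vertices in $\theta(L)$ are labeled. The square $HH$ is obtained from two disjoint copies of $H$ by identifying each labeled vertex $\theta(\ell)$ of the first copy with $\theta(\ell)$ of the second copy (keeping all edges, merging double edges). A graph $G$ is a square if $G\cong HH$ for some partially labeled graph $H$. -}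

module Defs where

open import Data.Nat using (ℕ; _+_; _%_; NonZero)
open import Data.Fin using (Fin; toℕ)
open import Data.Fin.Subset using (Subset; _∈_; _∉_)
open import Data.Product using (Σ; ∃; ∃-syntax; _×_; _,_)
open import Data.Sum using (_⊎_; inj₁; inj₂)
open import Relation.Nullary using (¬_)
open import Relation.Binary.PropositionalEquality using (_≡_)
open import Function.Bundles using (_↔_; Inverse; _⇔_)

record SimpleGraph (m : ℕ) : Set₁ where
  field
    Adj   : Fin m → Fin m → Set
    sym   : ∀ {u v} → Adj u v → Adj v u
    irrefl : ∀ {v} → ¬ Adj v v

-- A partially labeled graph: a simple graph H together with the set of labeled
-- vertices (the image θ(L) of the injective labeling), required nonempty and proper.
record PLGraph (m : ℕ) : Set₁ where
  field
    graph    : SimpleGraph m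
    labeled  : Subset m
    nonempty : ∃[ v ] (v ∈ labeled)
    proper   : ∃[ v ] (v ∉ labeled)
  open SimpleGraph graph public

-- Vertices of the square HH: all vertices of the first copy, plus the
-- unlabeled vertices of the second copy (labeled ones are identified
-- with those of the first copy).
SqVertex : ∀ {m} → PLGraph m → Set
SqVertex {m} H = Fin m ⊎ Σ (Fin m) (λ v → v ∉ PLGraph.labeled H)

-- Adjacency in HH: an edge uv of H appears in both copies; a labeled endpoint
-- of a second-copy edge is the (shared) first-copy vertex.
SqAdj : ∀ {m} (H : PLGraph m) → SqVertex H → SqVertex H → Set
SqAdj H (inj₁ u)       (inj₁ v)       = PLGraph.Adj H u v
SqAdj H (inj₂ (u , _)) (inj₂ (v , _)) = PLGraph.Adj H u v
SqAdj H (inj₁ u)       (inj₂ (v , _)) = u ∈ PLGraph.labeled H × PLGraph.Adj H u v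
SqAdj H (inj₂ (u , _)) (inj₁ v)       = v ∈ PLGraph.labeled H × PLGraph.Adj H u v

IsoToSquare : ∀ {n m} → (Fin n → Fin n → Set) → PLGraph m → Set
IsoToSquare {n} GAdj H =
  Σ (Fin n ↔ SqVertex H) λ f →
    ∀ i j → GAdj i j ⇔ SqAdj H (Inverse.to f i) (Inverse.to f j)

IsSquare : ∀ {n} → (Fin n → Fin n → Set) → Set₁
IsSquare {n} GAdj = ∃[ m ] Σ (PLGraph m) λ H → IsoToSquare GAdj H

CircAdj : (n d : ℕ) .{{_ : NonZero n}} → Fin n → Fin n → Set
CircAdj n d i j =
    (toℕ i + 1) % n ≡ toℕ j ⊎ (toℕ j + 1) % n ≡ toℕ i
  ⊎ (toℕ i + d) % n ≡ toℕ j ⊎ (toℕ j + d) % n ≡ toℕ i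

{-# OPTIONS --safe #-}

-- Exchanging the two copies of H is an automorphism of HH fixing exactly the
-- labelled vertices; on C_n^{1,d} it becomes an automorphism σ with a fixed
-- vertex s whose neighbour s + 1 moves.  For d ≥ 4 and n ≥ 2d + 3 the only
-- common neighbour of y and y + 2 is y + 1, which makes σ an involution and
-- forces σ (s + k) = s + k e for a step e ∈ {±1, ±d}.  Then e = 1 fixes s + 1,
-- e = ±d gives d² ≡ e² ≡ 1 (mod n) against 1 < d² < n, and for e = −1 the moved
-- vertices s + 1, s + 1 + d, s + d, s + d − 1, s − 1 form a path, along which
-- no edge changes copy, from s + 1 to σ (s + 1), which lies in the other copy.
module Submission where

open import Defs
open import Data.Bool using (Bool; true; false; not)
open import Data.Bool.Properties using (not-¬)
open import Data.Empty using (⊥; ⊥-elim)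
open import Data.Fin using (Fin; toℕ; _≟_)
open import Data.Fin.Properties using (toℕ-injective; toℕ<n; toℕ-fromℕ<)
open import Data.Fin.Subset using (_∈_)
open import Data.Fin.Subset.Properties using (_∈?_)
open import Data.Nat using (ℕ; zero; suc; _+_; _*_; _∸_; _≤_; _<_; z≤n; s≤s; NonZero)
open import Data.Nat.DivMod using (_%_; _mod_; m<n⇒m%n≡m; m%n<n; %-distribˡ-+; m%n%n≡m%n; n%n≡0; [m+n]%n≡m%n; [m+kn]%n≡m%n; m*n%n≡0)
open import Data.Nat.Properties
  using ( <-trans; <-cmp; <⇒≢; <⇒≤; ≤-trans; ≤-refl; ≤-reflexive; n≤1+n; n<1+n; m<n⇒m<1+n
        ; m<1+n⇒m<n∨m≡n; m≤m+n; m≤n+m; m≤n⇒∃[o]m+o≡n; m+[n∸m]≡n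
        ; +-identityʳ; +-assoc; +-comm; +-suc; *-suc
        ; +-mono-≤; +-monoˡ-≤; +-monoʳ-≤; +-monoʳ-<; module ≤-Reasoning )
open import Data.Nat.Tactic.RingSolver using (solve-∀)
open import Data.Product using (∃-syntax; _×_; _,_; proj₁; proj₂)
open import Data.Sum using (_⊎_; inj₁; inj₂; [_,_]′; map₂)
open import Function using (id; _∘_)
open import Function.Bundles using (Inverse; Equivalence; _⇔_; mk⇔)
open import Relation.Binary.Definitions using (tri<; tri≈; tri>)
open import Relation.Binary.PropositionalEquality
open import Relation.Nullary using (¬_; yes; no)
open import Relation.Unary using (Decidable)

module _ {f : ℕ → ℕ} (f-increasing : ∀ i → f i < f (suc i)) where

  increasing⇒< : ∀ {i j} → i < j → f i < f j
  increasing⇒< {i} {suc j} i<1+j with m<1+n⇒m<n∨m≡n i<1+j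
  ... | inj₁ i<j  = <-trans (increasing⇒< i<j) (f-increasing j)
  ... | inj₂ refl = f-increasing i

  increasing⇒injective : ∀ {i j} → f i ≡ f j → i ≡ j
  increasing⇒injective {i} {j} fi≡fj with <-cmp i j
  ... | tri< i<j _ _ = ⊥-elim (<⇒≢ (increasing⇒< i<j) fi≡fj)
  ... | tri≈ _ i≡j _ = i≡j
  ... | tri> _ _ j<i = ⊥-elim (<⇒≢ (increasing⇒< j<i) (sym fi≡fj))

module Cyclic (n : ℕ) .{{_ : NonZero n}} where

  infixl 6 _⊕_

  _⊕_ : Fin n → ℕ → Fin n
  x ⊕ k = (toℕ x + k) mod n

  toℕ-⊕ : ∀ x k → toℕ (x ⊕ k) ≡ (toℕ x + k) % n
  toℕ-⊕ x k = toℕ-fromℕ< (m%n<n (toℕ x + k) n)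

  toℕ⇒⊕ : ∀ x k {y} → (toℕ x + k) % n ≡ toℕ y → y ≡ x ⊕ k
  toℕ⇒⊕ x k eq = toℕ-injective (trans (sym eq) (sym (toℕ-⊕ x k)))

  ⊕⇒toℕ : ∀ x k {y} → y ≡ x ⊕ k → (toℕ x + k) % n ≡ toℕ y
  ⊕⇒toℕ x k refl = sym (toℕ-⊕ x k)

  [m%n+k]%n≡[m+k]%n : ∀ m k → (m % n + k) % n ≡ (m + k) % n
  [m%n+k]%n≡[m+k]%n m k = begin
    (m % n + k) % n          ≡⟨ %-distribˡ-+ (m % n) k n ⟩
    (m % n % n + k % n) % n  ≡⟨ cong (λ r → (r + k % n) % n) (m%n%n≡m%n m n) ⟩
    (m % n + k % n) % n      ≡⟨ %-distribˡ-+ m k n ⟨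
    (m + k) % n              ∎
    where open ≡-Reasoning

  ⊕-identityʳ : ∀ x → x ⊕ 0 ≡ x
  ⊕-identityʳ x = toℕ-injective (begin
    toℕ (x ⊕ 0)      ≡⟨ toℕ-⊕ x 0 ⟩
    (toℕ x + 0) % n  ≡⟨ cong (_% n) (+-identityʳ (toℕ x)) ⟩
    toℕ x % n        ≡⟨ m<n⇒m%n≡m (toℕ<n x) ⟩
    toℕ x            ∎)
    where open ≡-Reasoning

  ⊕-assoc : ∀ x a b → x ⊕ a ⊕ b ≡ x ⊕ (a + b)
  ⊕-assoc x a b = toℕ-injective (begin
    toℕ (x ⊕ a ⊕ b)            ≡⟨ toℕ-⊕ (x ⊕ a) b ⟩
    (toℕ (x ⊕ a) + b) % n      ≡⟨ cong (λ r → (r + b) % n) (toℕ-⊕ x a) ⟩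
    ((toℕ x + a) % n + b) % n  ≡⟨ [m%n+k]%n≡[m+k]%n (toℕ x + a) b ⟩
    (toℕ x + a + b) % n        ≡⟨ cong (_% n) (+-assoc (toℕ x) a b) ⟩
    (toℕ x + (a + b)) % n      ≡⟨ toℕ-⊕ x (a + b) ⟨
    toℕ (x ⊕ (a + b))          ∎)
    where open ≡-Reasoning

  ⊕-right-comm : ∀ x a b → x ⊕ a ⊕ b ≡ x ⊕ b ⊕ a
  ⊕-right-comm x a b =
    trans (⊕-assoc x a b) (trans (cong (x ⊕_) (+-comm a b)) (sym (⊕-assoc x b a)))

  ⊕-cong : ∀ x {a b} → a % n ≡ b % n → x ⊕ a ≡ x ⊕ b
  ⊕-cong x {a} {b} eq = toℕ-injective (begin
    toℕ (x ⊕ a)                  ≡⟨ toℕ-⊕ x a ⟩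
    (toℕ x + a) % n              ≡⟨ %-distribˡ-+ (toℕ x) a n ⟩
    (toℕ x % n + a % n) % n      ≡⟨ cong (λ r → (toℕ x % n + r) % n) eq ⟩
    (toℕ x % n + b % n) % n      ≡⟨ %-distribˡ-+ (toℕ x) b n ⟨
    (toℕ x + b) % n              ≡⟨ toℕ-⊕ x b ⟨
    toℕ (x ⊕ b)                  ∎)
    where open ≡-Reasoning

  ⊕-complement : ∀ x {a b} → a + b ≡ n → x ⊕ a ⊕ b ≡ x
  ⊕-complement x {a} {b} a+b≡n = begin
    x ⊕ a ⊕ b    ≡⟨ ⊕-assoc x a b ⟩
    x ⊕ (a + b)  ≡⟨ cong (x ⊕_) a+b≡n ⟩
    x ⊕ n        ≡⟨ ⊕-cong x ([m+n]%n≡m%n 0 n) ⟩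
    x ⊕ 0        ≡⟨ ⊕-identityʳ x ⟩
    x            ∎
    where open ≡-Reasoning

  toℕ-⊕-negate : ∀ x → toℕ (x ⊕ (n ∸ toℕ x)) ≡ 0
  toℕ-⊕-negate x = begin
    toℕ (x ⊕ (n ∸ toℕ x))        ≡⟨ toℕ-⊕ x (n ∸ toℕ x) ⟩
    (toℕ x + (n ∸ toℕ x)) % n    ≡⟨ cong (_% n) (m+[n∸m]≡n (<⇒≤ (toℕ<n x))) ⟩
    n % n                        ≡⟨ n%n≡0 n ⟩
    0                            ∎
    where open ≡-Reasoning

  ⊕-cancelˡ : ∀ x {a b} → x ⊕ a ≡ x ⊕ b → a % n ≡ b % n
  ⊕-cancelˡ x {a} {b} eq =
    trans (sym (unshift a)) (trans (cong (λ y → toℕ (y ⊕ x̄)) eq) (unshift b))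
    where
    open ≡-Reasoning
    x̄ = n ∸ toℕ x
    unshift : ∀ k → toℕ (x ⊕ k ⊕ x̄) ≡ k % n
    unshift k = begin
      toℕ (x ⊕ k ⊕ x̄)          ≡⟨ cong toℕ (⊕-right-comm x k x̄) ⟩
      toℕ (x ⊕ x̄ ⊕ k)          ≡⟨ toℕ-⊕ (x ⊕ x̄) k ⟩
      (toℕ (x ⊕ x̄) + k) % n    ≡⟨ cong (λ r → (r + k) % n) (toℕ-⊕-negate x) ⟩
      k % n                    ∎

  ⊕-reach : ∀ x y → x ⊕ (n ∸ toℕ x + toℕ y) ≡ y
  ⊕-reach x y = toℕ-injective (begin
    toℕ (x ⊕ (x̄ + toℕ y))      ≡⟨ cong toℕ (⊕-assoc x x̄ (toℕ y)) ⟨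
    toℕ (x ⊕ x̄ ⊕ toℕ y)        ≡⟨ toℕ-⊕ (x ⊕ x̄) (toℕ y) ⟩
    (toℕ (x ⊕ x̄) + toℕ y) % n  ≡⟨ cong (λ r → (r + toℕ y) % n) (toℕ-⊕-negate x) ⟩
    toℕ y % n                  ≡⟨ m<n⇒m%n≡m (toℕ<n y) ⟩
    toℕ y                      ∎)
    where
    open ≡-Reasoning
    x̄ = n ∸ toℕ x

  boundary : ∀ {p} {P : Fin n → Set p} → Decidable P →
             ∀ {x y} → P x → ¬ P y → ∃[ s ] P s × ¬ P (s ⊕ 1)
  boundary {P = P} P? {x} {y} px ¬py =
    [ id , ⊥-elim ∘ ¬py ∘ subst P (⊕-reach x y) ]′ (walk (n ∸ toℕ x + toℕ y) px)
    where
    walk : ∀ k {z} → P z → (∃[ s ] P s × ¬ P (s ⊕ 1)) ⊎ P (z ⊕ k)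
    walk zero    {z} pz = inj₂ (subst P (sym (⊕-identityʳ z)) pz)
    walk (suc k) {z} pz with P? (z ⊕ 1)
    ... | no ¬pz⊕1 = inj₁ (z , pz , ¬pz⊕1)
    ... | yes pz⊕1 = map₂ (subst P (⊕-assoc z 1 k)) (walk k pz⊕1)

module Swap {m : ℕ} (H : PLGraph m) where
  open PLGraph H using (labeled)

  swap : SqVertex H → SqVertex H
  swap (inj₁ v) with v ∈? labeled
  ... | yes _  = inj₁ v
  ... | no v∉ = inj₂ (v , v∉)
  swap (inj₂ (v , _)) = inj₁ v

  Shared : SqVertex H → Set
  Shared (inj₁ v) = v ∈ labeled
  Shared (inj₂ _) = ⊥

  copy : SqVertex H → Bool
  copy (inj₁ _) = true
  copy (inj₂ _) = false

  swap-shared : ∀ a → Shared a → swap a ≡ a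
  swap-shared (inj₁ v) v∈ with v ∈? labeled
  ... | yes _ = refl
  ... | no v∉ = ⊥-elim (v∉ v∈)

  swap-copy : ∀ a → ¬ Shared a → copy (swap a) ≡ not (copy a)
  swap-copy (inj₁ v) v∉ with v ∈? labeled
  ... | yes v∈ = ⊥-elim (v∉ v∈)
  ... | no _   = refl
  swap-copy (inj₂ _) _ = refl

  swap-unshared : ∀ a → ¬ Shared a → swap a ≢ a
  swap-unshared a ¬shared swap-a≡a =
    not-¬ refl (trans (cong copy (sym swap-a≡a)) (swap-copy a ¬shared))

  copy-adj : ∀ a b → SqAdj H a b → ¬ Shared a → ¬ Shared b → copy a ≡ copy b
  copy-adj (inj₁ _) (inj₁ _) _        _  _  = refl
  copy-adj (inj₂ _) (inj₂ _) _        _  _  = refl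
  copy-adj (inj₁ _) (inj₂ _) (u∈ , _) u∉ _  = ⊥-elim (u∉ u∈)
  copy-adj (inj₂ _) (inj₁ _) (v∈ , _) _  v∉ = ⊥-elim (v∉ v∈)

  swap-adj : ∀ a b → SqAdj H a b → SqAdj H (swap a) (swap b)
  swap-adj (inj₁ u) (inj₁ v) uv with u ∈? labeled | v ∈? labeled
  ... | yes _  | yes _  = uv
  ... | yes u∈ | no _   = u∈ , uv
  ... | no _   | yes v∈ = v∈ , uv
  ... | no _   | no _   = uv
  swap-adj (inj₁ u) (inj₂ _) (u∈ , uv) with u ∈? labeled
  ... | yes _ = uv
  ... | no u∉ = ⊥-elim (u∉ u∈)
  swap-adj (inj₂ _) (inj₁ v) (v∈ , uv) with v ∈? labeled
  ... | yes _ = uv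
  ... | no v∉ = ⊥-elim (v∉ v∈)
  swap-adj (inj₂ _) (inj₂ _) uv = uv

  -- Stands in for swap (swap a) ≡ a: on a second-copy vertex the two sides
  -- differ in the proof of non-membership, equal only under function
  -- extensionality, but SqAdj ignores that proof.
  swap²-adj : ∀ a b → SqAdj H a b → SqAdj H (swap (swap a)) b
  swap²-adj (inj₁ u) b ab with u ∈? labeled
  ... | yes u∈ = subst (λ a → SqAdj H a b) (sym (swap-shared (inj₁ u) u∈)) ab
  ... | no _   = ab
  swap²-adj (inj₂ (u , u∉)) b ab with u ∈? labeled
  swap²-adj (inj₂ (u , u∉)) b        ab | yes u∈ = ⊥-elim (u∉ u∈)
  swap²-adj (inj₂ (u , u∉)) (inj₁ _) ab | no _   = ab
  swap²-adj (inj₂ (u , u∉)) (inj₂ _) ab | no _   = ab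

-- What exchanging the two copies of H leaves visible on a graph G ≅ HH:
-- σ fixes exactly the labelled vertices, and every other vertex lies in a
-- copy which σ switches and which is constant along edges between them.
record CopySwap {n : ℕ} (G : Fin n → Fin n → Set) : Set where
  field
    σ        : Fin n → Fin n
    σ-adj    : ∀ {x y} → G x y → G (σ x) (σ y)
    σ²-adj   : ∀ {x y} → G x y → G (σ (σ x)) y
    copy     : Fin n → Bool
    copy-σ   : ∀ {x} → σ x ≢ x → copy (σ x) ≡ not (copy x)
    copy-adj : ∀ {x y} → G x y → σ x ≢ x → σ y ≢ y → copy x ≡ copy y
    fixed    : ∃[ x ] σ x ≡ x
    moved    : ∃[ x ] σ x ≢ x

square⇒copySwap : ∀ {n} {G : Fin n → Fin n → Set} → IsSquare G → CopySwap G
square⇒copySwap {G = G} (_ , H , φ , φ-adj) = record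
  { σ        = σ
  ; σ-adj    = λ {x} {y} xy → fromSq (subst₂ (SqAdj H) (sym (fσ x)) (sym (fσ y))
                                        (swap-adj (f x) (f y) (toSq xy)))
  ; σ²-adj   = λ {x} {y} xy → fromSq (subst (λ a → SqAdj H a (f y)) (sym (fσ² x))
                                        (swap²-adj (f x) (f y) (toSq xy)))
  ; copy     = copy ∘ f
  ; copy-σ   = λ {x} σx≢x → trans (cong copy (fσ x)) (swap-copy (f x) (unshared σx≢x))
  ; copy-adj = λ xy σx≢x σy≢y → copy-adj _ _ (toSq xy) (unshared σx≢x) (unshared σy≢y)
  ; fixed    = g (inj₁ v) , shared⇒fixed (subst Shared (sym (fg (inj₁ v))) v∈)
  ; moved    = g (inj₁ w) , λ σx≡x → swap-unshared (inj₁ w) w∉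
                 (trans (sym (fσ-inj₁ w)) (trans (cong f σx≡x) (fg (inj₁ w))))
  }
  where
  open Swap H
  open PLGraph H using (nonempty; proper)
  v = proj₁ nonempty
  v∈ = proj₂ nonempty
  w = proj₁ proper
  w∉ = proj₂ proper
  f = Inverse.to φ
  g = Inverse.from φ
  fg : ∀ a → f (g a) ≡ a
  fg = Inverse.strictlyInverseˡ φ
  toSq : ∀ {x y} → G x y → SqAdj H (f x) (f y)
  toSq {x} {y} = Equivalence.to (φ-adj x y)
  fromSq : ∀ {x y} → SqAdj H (f x) (f y) → G x y
  fromSq {x} {y} = Equivalence.from (φ-adj x y)
  σ : Fin _ → Fin _
  σ x = g (swap (f x))
  fσ : ∀ x → f (σ x) ≡ swap (f x)
  fσ x = fg (swap (f x))
  fσ² : ∀ x → f (σ (σ x)) ≡ swap (swap (f x))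
  fσ² x = trans (fσ (σ x)) (cong swap (fσ x))
  fσ-inj₁ : ∀ u → f (σ (g (inj₁ u))) ≡ swap (inj₁ u)
  fσ-inj₁ u = trans (fσ (g (inj₁ u))) (cong swap (fg (inj₁ u)))
  shared⇒fixed : ∀ {x} → Shared (f x) → σ x ≡ x
  shared⇒fixed {x} shared =
    trans (cong g (swap-shared (f x) shared)) (Inverse.strictlyInverseʳ φ x)
  unshared : ∀ {x} → σ x ≢ x → ¬ Shared (f x)
  unshared σx≢x = σx≢x ∘ shared⇒fixed

CopySwap-resp-⇔ : ∀ {n} {G G′ : Fin n → Fin n → Set} →
                  (∀ x y → G x y ⇔ G′ x y) → CopySwap G → CopySwap G′
CopySwap-resp-⇔ {G = G} {G′} G⇔G′ S = record
  { σ        = σ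
  ; σ-adj    = to ∘ σ-adj ∘ from
  ; σ²-adj   = to ∘ σ²-adj ∘ from
  ; copy     = copy
  ; copy-σ   = copy-σ
  ; copy-adj = copy-adj ∘ from
  ; fixed    = fixed
  ; moved    = moved
  }
  where
  open CopySwap S
  to : ∀ {x y} → G x y → G′ x y
  to {x} {y} = Equivalence.to (G⇔G′ x y)
  from : ∀ {x y} → G′ x y → G x y
  from {x} {y} = Equivalence.from (G⇔G′ x y)

-- d = 4 + u and c = n − d = 3 + d + t encode d ≥ 4 and n ≥ 2d + 3, and make
-- most of the arithmetic below hold by computation.
module Circulant (u t : ℕ) where

  d c n : ℕ
  d = 4 + u
  c = 3 + d + t
  n = d + (3 + d) + t

  open Cyclic n

  d+c≡n : d + c ≡ n
  d+c≡n = sym (+-assoc d (3 + d) t)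

  data Step : Set where
    +1 −1 +d −d : Step

  val : Step → ℕ
  val +1 = 1
  val −1 = n ∸ 1
  val +d = d
  val −d = c

  opp : Step → Step
  opp +1 = −1
  opp −1 = +1
  opp +d = −d
  opp −d = +d

  val+val-opp≡n : ∀ e → val e + val (opp e) ≡ n
  val+val-opp≡n +1 = refl
  val+val-opp≡n −1 = +-comm (n ∸ 1) 1
  val+val-opp≡n +d = d+c≡n
  val+val-opp≡n −d = trans (+-comm c d) d+c≡n

  infix 4 _~_

  _~_ : Fin n → Fin n → Set
  x ~ y = ∃[ e ] y ≡ x ⊕ val e

  ~-sym : ∀ {x y} → x ~ y → y ~ x
  ~-sym {x} (e , y≡x⊕e) =
    opp e , sym (trans (cong (_⊕ val (opp e)) y≡x⊕e) (⊕-complement x (val+val-opp≡n e)))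

  ~-shift : ∀ x {a b} e → a + val e ≡ b → x ⊕ a ~ x ⊕ b
  ~-shift x {a} e a+e≡b = e , trans (cong (x ⊕_) (sym a+e≡b)) (sym (⊕-assoc x a (val e)))

  circAdj⇔~ : ∀ x y → CircAdj n d x y ⇔ x ~ y
  circAdj⇔~ x y = mk⇔ to from
    where
    to : CircAdj n d x y → x ~ y
    to (inj₁ eq)               = +1 , toℕ⇒⊕ x 1 eq
    to (inj₂ (inj₁ eq))        = ~-sym (+1 , toℕ⇒⊕ y 1 eq)
    to (inj₂ (inj₂ (inj₁ eq))) = +d , toℕ⇒⊕ x d eq
    to (inj₂ (inj₂ (inj₂ eq))) = ~-sym (+d , toℕ⇒⊕ y d eq)
    from : x ~ y → CircAdj n d x y
    from (+1 , eq) = inj₁ (⊕⇒toℕ x 1 eq)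
    from (−1 , eq) = inj₂ (inj₁ (⊕⇒toℕ y 1 (proj₂ (~-sym (−1 , eq)))))
    from (+d , eq) = inj₂ (inj₂ (inj₁ (⊕⇒toℕ x d eq)))
    from (−d , eq) = inj₂ (inj₂ (inj₂ (⊕⇒toℕ y d (proj₂ (~-sym (−d , eq))))))

  -- The residues of the steps e and of the shifted steps 2 + e interleave on
  -- this increasing sequence and meet only in 1 = 2 + (n - 1) mod n.
  ladder : ℕ → ℕ
  ladder 0 = 1
  ladder 1 = 3
  ladder 2 = d
  ladder 3 = 2 + d
  ladder 4 = c
  ladder 5 = 2 + c
  ladder (suc (suc (suc (suc (suc (suc k)))))) = k + (n ∸ 1)

  ladder-increasing : ∀ i → ladder i < ladder (suc i)
  ladder-increasing 0 = s≤s (s≤s z≤n)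
  ladder-increasing 1 = s≤s (s≤s (s≤s (s≤s z≤n)))
  ladder-increasing 2 = m<n⇒m<1+n (n<1+n d)
  ladder-increasing 3 = m≤m+n (3 + d) t
  ladder-increasing 4 = m<n⇒m<1+n (n<1+n c)
  ladder-increasing 5 = +-monoʳ-≤ 3 (+-monoˡ-≤ t (m≤n+m (3 + d) u))
  ladder-increasing (suc (suc (suc (suc (suc (suc k)))))) = n<1+n _

  step-rung shifted-rung : Step → ℕ
  step-rung +1 = 0
  step-rung +d = 2
  step-rung −d = 4
  step-rung −1 = 6
  shifted-rung −1 = 0
  shifted-rung +1 = 1
  shifted-rung +d = 3
  shifted-rung −d = 5

  2+d<n : 2 + d < n
  2+d<n = ≤-trans (m≤n+m (3 + d) d) (m≤m+n (d + (3 + d)) t)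

  2+c<n : 2 + c < n
  2+c<n = subst (3 + c ≤_) d+c≡n (+-monoˡ-≤ c {3} {d} (s≤s (s≤s (s≤s z≤n))))

  double<n : ∀ {k} → k ≤ 1 + d → k + k < n
  double<n {k} k≤1+d = begin-strict
    k + k                ≤⟨ +-mono-≤ k≤1+d k≤1+d ⟩
    (1 + d) + (1 + d)    ≡⟨ +-suc d (1 + d) ⟨
    d + (2 + d)          <⟨ +-monoʳ-< d (ladder-increasing 3) ⟩
    d + c                ≡⟨ d+c≡n ⟩
    n                    ∎
    where open ≤-Reasoning

  val%n : ∀ e → val e % n ≡ ladder (step-rung e)
  val%n +1 = refl
  val%n −1 = m<n⇒m%n≡m (n<1+n (n ∸ 1))
  val%n +d = m<n⇒m%n≡m (<-trans (m<n⇒m<1+n (n<1+n d)) 2+d<n)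
  val%n −d = m<n⇒m%n≡m (<-trans (m<n⇒m<1+n (n<1+n c)) 2+c<n)

  [2+val]%n : ∀ e → (2 + val e) % n ≡ ladder (shifted-rung e)
  [2+val]%n +1 = refl
  [2+val]%n −1 = [m+n]%n≡m%n 1 n
  [2+val]%n +d = m<n⇒m%n≡m 2+d<n
  [2+val]%n −d = m<n⇒m%n≡m 2+c<n

  rungs-meet : ∀ a b → step-rung a ≡ shifted-rung b → val a ≡ 1
  rungs-meet +1 _  _  = refl
  rungs-meet −1 +1 ()
  rungs-meet −1 −1 ()
  rungs-meet −1 +d ()
  rungs-meet −1 −d ()
  rungs-meet +d +1 ()
  rungs-meet +d −1 ()
  rungs-meet +d +d ()
  rungs-meet +d −d ()
  rungs-meet −d +1 ()
  rungs-meet −d −1 ()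
  rungs-meet −d +d ()
  rungs-meet −d −d ()

  common-neighbour : ∀ y {z} → y ~ z → y ⊕ 1 ⊕ 1 ~ z → z ≡ y ⊕ 1
  common-neighbour y (a , refl) (b , eq) =
    cong (y ⊕_) (rungs-meet a b (increasing⇒injective ladder-increasing same-residue))
    where
    open ≡-Reasoning
    y⊕1⊕1⊕b : y ⊕ 1 ⊕ 1 ⊕ val b ≡ y ⊕ (2 + val b)
    y⊕1⊕1⊕b = trans (⊕-assoc (y ⊕ 1) 1 (val b)) (⊕-assoc y 1 (1 + val b))
    same-residue : ladder (step-rung a) ≡ ladder (shifted-rung b)
    same-residue = begin
      ladder (step-rung a)     ≡⟨ val%n a ⟨
      val a % n                ≡⟨ ⊕-cancelˡ y (trans eq y⊕1⊕1⊕b) ⟩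
      (2 + val b) % n          ≡⟨ [2+val]%n b ⟩
      ladder (shifted-rung b)  ∎

  d²≢1 : d * d ≢ 1
  d²≢1 ()

  c²%n≡d²%n : c * c % n ≡ d * d % n
  c²%n≡d²%n = trans (cong (_% n) (c² d t)) ([m+kn]%n≡m%n (d * d) (3 + t) n)
    where
    c² : ∀ d t → (3 + d + t) * (3 + d + t) ≡ d * d + (3 + t) * (d + (3 + d) + t)
    c² = solve-∀

  module Swapped (S : CopySwap _~_) where
    open CopySwap S

    σ-involutive : ∀ x → σ (σ x) ≡ x
    σ-involutive x = trans (common-neighbour p p~σ²x p⊕1⊕1~σ²x) p⊕1≡x
      where
      p = x ⊕ (n ∸ 1)
      p⊕1≡x : p ⊕ 1 ≡ x
      p⊕1≡x = ⊕-complement x (val+val-opp≡n −1)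
      p~σ²x : p ~ σ (σ x)
      p~σ²x = ~-sym (σ²-adj (−1 , refl))
      p⊕1⊕1~σ²x : p ⊕ 1 ⊕ 1 ~ σ (σ x)
      p⊕1⊕1~σ²x = subst (λ q → q ⊕ 1 ~ σ (σ x)) (sym p⊕1≡x) (~-sym (σ²-adj (+1 , refl)))

    σ-moved : ∀ {x} → σ x ≢ x → σ (σ x) ≢ σ x
    σ-moved {x} σx≢x σ²x≡σx = σx≢x (sym (trans (sym (σ-involutive x)) σ²x≡σx))

    -- σ z is a common neighbour of x and x + 2, where z = σ x + f.
    straight : ∀ x e → σ (x ⊕ 1) ≡ σ x ⊕ val e → σ (x ⊕ 1 ⊕ 1) ≡ σ (x ⊕ 1) ⊕ val e
    straight x e σx⊕1≡ with σ-adj {x ⊕ 1} (+1 , refl)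
    ... | f , σx⊕2≡ = trans σx⊕2≡ (⊕-cong (σ (x ⊕ 1)) (⊕-cancelˡ (σ x) z≡σx⊕e))
      where
      z = σ x ⊕ val f
      σx⊕2≡z⊕e : σ (x ⊕ 1 ⊕ 1) ≡ z ⊕ val e
      σx⊕2≡z⊕e = trans σx⊕2≡ (trans (cong (_⊕ val f) σx⊕1≡) (⊕-right-comm (σ x) (val e) (val f)))
      x~σz : x ~ σ z
      x~σz = subst (_~ σ z) (σ-involutive x) (σ-adj (f , refl))
      x⊕1⊕1~σz : x ⊕ 1 ⊕ 1 ~ σ z
      x⊕1⊕1~σz = subst (_~ σ z) (σ-involutive _) (σ-adj (~-sym (e , σx⊕2≡z⊕e)))
      z≡σx⊕e : z ≡ σ x ⊕ val e
      z≡σx⊕e = trans (sym (σ-involutive z))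
                     (trans (cong σ (common-neighbour x x~σz x⊕1⊕1~σz)) σx⊕1≡)

    progression : ∀ {x} e → σ (x ⊕ 1) ≡ σ x ⊕ val e → ∀ k → σ (x ⊕ k) ≡ σ x ⊕ k * val e
    progression {x} e σx⊕1≡ zero = trans (cong σ (⊕-identityʳ x)) (sym (⊕-identityʳ (σ x)))
    progression {x} e σx⊕1≡ (suc k) = begin
      σ (x ⊕ suc k)              ≡⟨ cong σ (⊕-assoc x 1 k) ⟨
      σ (x ⊕ 1 ⊕ k)              ≡⟨ progression e (straight x e σx⊕1≡) k ⟩
      σ (x ⊕ 1) ⊕ k * val e      ≡⟨ cong (_⊕ k * val e) σx⊕1≡ ⟩
      σ x ⊕ val e ⊕ k * val e    ≡⟨ ⊕-assoc (σ x) (val e) (k * val e) ⟩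
      σ x ⊕ suc k * val e        ∎
      where open ≡-Reasoning

    module _ {s : Fin n} (s-fixed : σ s ≡ s) where

      step²≡1 : ∀ e → σ (s ⊕ 1) ≡ σ s ⊕ val e → val e * val e % n ≡ 1
      step²≡1 e σs⊕1≡ = sym (⊕-cancelˡ s (begin
        s ⊕ 1                  ≡⟨ σ-involutive (s ⊕ 1) ⟨
        σ (σ (s ⊕ 1))          ≡⟨ cong σ (trans σs⊕1≡ (cong (_⊕ val e) s-fixed)) ⟩
        σ (s ⊕ val e)          ≡⟨ progression e σs⊕1≡ (val e) ⟩
        σ s ⊕ val e * val e    ≡⟨ cong (_⊕ val e * val e) s-fixed ⟩
        s ⊕ val e * val e      ∎))
        where open ≡-Reasoning

      module _ (σs⊕1≡ : σ (s ⊕ 1) ≡ σ s ⊕ val −1) where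

        reflection : ∀ k → σ (s ⊕ k) ≡ s ⊕ k * (n ∸ 1)
        reflection k = trans (progression −1 σs⊕1≡ k) (cong (_⊕ k * (n ∸ 1)) s-fixed)

        reflection-moves : ∀ k → suc k ≤ 1 + d → σ (s ⊕ suc k) ≢ s ⊕ suc k
        reflection-moves k k<1+d fixes = 2k+2≢0 (begin
          suc k + suc k          ≡⟨ m<n⇒m%n≡m (double<n k<1+d) ⟨
          (suc k + suc k) % n    ≡⟨ ⊕-cancelˡ s s⊕2k+2≡s ⟩
          0                      ∎)
          where
          open ≡-Reasoning
          2k+2≢0 : suc k + suc k ≢ 0
          2k+2≢0 ()
          s⊕2k+2≡s : s ⊕ (suc k + suc k) ≡ s ⊕ 0
          s⊕2k+2≡s = begin
            s ⊕ (suc k + suc k)            ≡⟨ ⊕-assoc s (suc k) (suc k) ⟨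
            s ⊕ suc k ⊕ suc k              ≡⟨ cong (_⊕ suc k) (trans (sym fixes) (reflection (suc k))) ⟩
            s ⊕ suc k * (n ∸ 1) ⊕ suc k    ≡⟨ ⊕-assoc s (suc k * (n ∸ 1)) (suc k) ⟩
            s ⊕ (suc k * (n ∸ 1) + suc k)  ≡⟨ cong (s ⊕_) (+-comm (suc k * (n ∸ 1)) (suc k)) ⟩
            s ⊕ (suc k + suc k * (n ∸ 1))  ≡⟨ cong (s ⊕_) (*-suc (suc k) (n ∸ 1)) ⟨
            s ⊕ suc k * n                  ≡⟨ ⊕-cong s (m*n%n≡0 (suc k) n) ⟩
            s ⊕ 0                          ∎

        reflection-impossible : σ (s ⊕ 1) ≢ s ⊕ 1 → ⊥
        reflection-impossible m₀ = not-¬ refl (begin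
          copy (s ⊕ 1)        ≡⟨ copy-adj (~-shift s +d refl) m₀ m₁ ⟩
          copy (s ⊕ (1 + d))  ≡⟨ copy-adj (~-shift s +1 (+-comm d 1)) m₂ m₁ ⟨
          copy (s ⊕ d)        ≡⟨ copy-adj (~-shift s +1 (+-comm (3 + u) 1)) m₃ m₂ ⟨
          copy (s ⊕ (3 + u))  ≡⟨ copy-adj (~-shift s −d (cong (3 +_) (sym (+-assoc u (3 + d) t)))) m₃ m₄ ⟩
          copy (s ⊕ (n ∸ 1))  ≡⟨ cong copy σs⊕1≡s⊕n-1 ⟨
          copy (σ (s ⊕ 1))    ≡⟨ copy-σ m₀ ⟩
          not (copy (s ⊕ 1))  ∎)
          where
          open ≡-Reasoning
          σs⊕1≡s⊕n-1 : σ (s ⊕ 1) ≡ s ⊕ (n ∸ 1)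
          σs⊕1≡s⊕n-1 = trans σs⊕1≡ (cong (_⊕ (n ∸ 1)) s-fixed)
          m₁ = reflection-moves d ≤-refl
          m₂ = reflection-moves (3 + u) (n≤1+n _)
          m₃ = reflection-moves (2 + u) (m≤n+m _ 2)
          m₄ = subst (λ q → σ q ≢ q) σs⊕1≡s⊕n-1 (σ-moved m₀)

      step-impossible : d * d < n → σ (s ⊕ 1) ≢ s ⊕ 1 → ∀ e → σ (s ⊕ 1) ≡ σ s ⊕ val e → ⊥
      step-impossible _    m₀ +1 σs⊕1≡ = m₀ (trans σs⊕1≡ (cong (_⊕ 1) s-fixed))
      step-impossible _    m₀ −1 σs⊕1≡ = reflection-impossible σs⊕1≡ m₀
      step-impossible d²<n _  +d σs⊕1≡ =
        d²≢1 (trans (sym (m<n⇒m%n≡m d²<n)) (step²≡1 +d σs⊕1≡))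
      step-impossible d²<n _  −d σs⊕1≡ =
        d²≢1 (trans (sym (m<n⇒m%n≡m d²<n)) (trans (sym c²%n≡d²%n) (step²≡1 −d σs⊕1≡)))

  no-copySwap : d * d < n → ¬ CopySwap _~_
  no-copySwap d²<n S =
    let s , s-fixed , s⊕1-moved = boundary (λ x → σ x ≟ x) (proj₂ fixed) (proj₂ moved)
        e , σs⊕1≡ = σ-adj {s} (+1 , refl)
    in step-impossible s-fixed d²<n s⊕1-moved e σs⊕1≡
    where
    open CopySwap S
    open Swapped S

  not-square : d * d < n → ¬ IsSquare (CircAdj n d)
  not-square d²<n = no-copySwap d²<n ∘ CopySwap-resp-⇔ circAdj⇔~ ∘ square⇒copySwap

2d+3≤d²+1 : ∀ u → (4 + u) + (3 + (4 + u)) ≤ (4 + u) * (4 + u) + 1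
2d+3≤d²+1 u = subst ((4 + u) + (3 + (4 + u)) ≤_) (excess u) (m≤m+n _ (6 + 6 * u + u * u))
  where
  excess : ∀ u → (4 + u) + (3 + (4 + u)) + (6 + 6 * u + u * u) ≡ (4 + u) * (4 + u) + 1
  excess = solve-∀

theorem4p12 : (d n : ℕ) → 4 ≤ d → d * d + 1 ≤ n → .{{_ : NonZero n}} →
    ¬ IsSquare (CircAdj n d)
theorem4p12 d n 4≤d d²+1≤n with m≤n⇒∃[o]m+o≡n 4≤d
... | u , refl with m≤n⇒∃[o]m+o≡n (≤-trans (2d+3≤d²+1 u) d²+1≤n)
...   | t , refl =
  Circulant.not-square u t (≤-trans (≤-reflexive (+-comm 1 ((4 + u) * (4 + u)))) d²+1≤n)
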